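{- Let $\ell\ge2$ and $k>\ell$ be integers. Then $\overline{\alpha}(\{1,\dots,\ell-1,k\})=\frac{1}{\ell}$ if $k\not\equiv0\pmod{\ell}$, and $\overline{\alpha}(\{1,\dots,\ell-1,k\})=\frac{k}{\ell(k+1)}$ if $k\equiv0\pmod{\ell}$.
   Context: For a finite set $S$ of positive integers, the distance graph $G(S)$ has vertex set $\mathbb{Z}$, with $i,j$ adjacent iff $|i-j|\in S$. For $A\subseteq\mathbb{Z}$, $\delta(A)=\limsup_{N\to\infty}\frac{|A\cap[-N,N]|}{2N+1}$. The independence ratio $\overline{\alpha}(S)$ is the supremum of $\delta(A)$ over all independent sets $A$ of $G(S)$. -}

module Defs where

open import Data.Bool using (Bool; true; false; if_then_else_)
open import Data.Nat as ℕ using (ℕ; zero; suc; _≤_; _<_)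
open import Data.Integer as ℤ using (ℤ; +_; ∣_∣)
open import Data.Rational as ℚ using (ℚ; 0ℚ; _/_)
open import Data.List using (List; map; upTo)
open import Data.Nat.ListAction using (sum)
open import Data.Product using (_×_; Σ; ∃; _,_)
open import Data.Sum using (_⊎_)
open import Data.Empty using (⊥)
open import Relation.Binary.PropositionalEquality using (_≡_)
open import Relation.Nullary using (¬_)

Subsetℤ : Set
Subsetℤ = ℤ → Bool

DistSet : Set₁
DistSet = ℕ → Set

S[_,_] : ℕ → ℕ → DistSet
S[ ℓ , k ] d = (1 ≤ d × d < ℓ) ⊎ d ≡ k

Independent : DistSet → Subsetℤ → Set
Independent S A = ∀ i j → A i ≡ true → A j ≡ true → ¬ S ∣ i ℤ.- j ∣

count : Subsetℤ → ℕ → ℕ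
count A N = sum (map (λ m → if A ((+ m) ℤ.- (+ N)) then 1 else 0) (upTo (suc (2 ℕ.* N))))

densityAt : Subsetℤ → ℕ → ℚ
densityAt A N = (+ count A N) / suc (2 ℕ.* N)

-- δ(A) ≤ r   (upper density = limsup of densityAt)
UpperDensity≤ : Subsetℤ → ℚ → Set
UpperDensity≤ A r = ∀ (ε : ℚ) → ℚ.Positive ε →
  Σ ℕ λ M → ∀ N → M ≤ N → densityAt A N ℚ.≤ r ℚ.+ ε

UpperDensity≥ : Subsetℤ → ℚ → Set
UpperDensity≥ A r = ∀ (ε : ℚ) → ℚ.Positive ε →
  ∀ M → Σ ℕ λ N → M ≤ N × r ℚ.- ε ℚ.≤ densityAt A N

-- ᾱ(S) = r : r is the supremum of δ(A) over independent sets A of G(S).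
IndependenceRatio≡ : DistSet → ℚ → Set
IndependenceRatio≡ S r =
  (∀ A → Independent S A → UpperDensity≤ A r) ×
  (∀ (ε : ℚ) → ℚ.Positive ε → Σ Subsetℤ λ A → Independent S A × UpperDensity≥ A (r ℚ.- ε))

-- the rational a / b (b ≠ 0; value 0 for b = 0, never used)
frac : ℕ → ℕ → ℚ
frac a zero = 0ℚ
frac a (suc b) = (+ a) / suc b

module Submission where

-- An independent set meets any ℓ consecutive integers at most once (their distances lie in
-- {1, …, ℓ-1}), so its upper density is at most 1/ℓ. When k = mℓ, a window of k + 1 consecutive
-- integers cannot contain both of its end points, so after dropping one of them it splits into m
-- blocks of length ℓ and holds at most m = k/ℓ points, which bounds the density by k/(ℓ(k+1)).
-- Both bounds are attained by periodic sets: the multiples of ℓ when ℓ ∤ k, and, when ℓ ∣ k,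
-- the integers whose residue modulo k + 1 is one of 0, ℓ, …, k - ℓ.

open import Defs
open import Data.Bool using (Bool; true; false; if_then_else_; _∧_)
open import Data.Bool.Properties using (∧-identityʳ; ∧-zeroʳ)
open import Data.Empty using (⊥; ⊥-elim)
open import Data.Integer as ℤ using (ℤ; +_; -[1+_]; ∣_∣; _%ℕ_; _/ℕ_)
import Data.Integer.Properties as ℤₚ
open import Data.Integer.DivMod using (a≡a%ℕn+[a/ℕn]*n; n%ℕd<d)
import Data.Integer.Tactic.RingSolver as ℤ-Solver
open import Data.List using (map; applyUpTo)
open import Data.Nat using (ℕ; zero; suc; z≤n; s≤s; z<s; s<s; _≤_; _<_; _+_; _*_; _∸_; _⊔_; NonZero; ≢-nonZero; >-nonZero; >-nonZero⁻¹)
open import Data.Nat.Coprimality using (Coprime)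
open import Data.Nat.DivMod using (_%_; _/_; m≡m%n+[m/n]*n; m%n<n; m/n*n≤m; [m+n]%n≡m%n; m*n%n≡0; m<n⇒m%n≡m; m%n%n≡m%n)
open import Data.Nat.Divisibility using (_∣_; m%n≡0⇒n∣m; n∣m⇒m%n≡0; _∣?_; divides; _∣0; >⇒∤; ∣m+n∣m⇒∣n; ∣m∣n⇒∣m+n; ∣-refl; ∣1⇒≡1)
open import Data.Nat.ListAction using (sum)
open import Data.Nat.Properties
open import Data.Nat.Tactic.RingSolver using (solve-∀)
open import Data.Product using (_×_; _,_; Σ)
open import Data.Rational as ℚ using (mkℚ)
import Data.Rational.Properties as ℚₚ
open import Data.Rational.Unnormalised as ℚᵘ using (mkℚᵘ; *≤*)
import Data.Rational.Unnormalised.Properties as ℚᵘₚ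
open import Data.Sum using (inj₁; inj₂)
open import Function using (_⇔_; mk⇔)
open import Relation.Binary.PropositionalEquality
open import Relation.Nullary using (Dec; does; yes; ¬_; _×-dec_; contradiction)
open import Relation.Nullary.Decidable using (dec-true; dec-false; does-⇔)

𝟙 : Bool → ℕ
𝟙 b = if b then 1 else 0

∑ : ℕ → (ℕ → ℕ) → ℕ
∑ zero    f = 0
∑ (suc n) f = f 0 + ∑ n (λ i → f (suc i))

sum-map-applyUpTo : ∀ (h f : ℕ → ℕ) n → sum (map h (applyUpTo f n)) ≡ ∑ n (λ i → h (f i))
sum-map-applyUpTo h f zero    = refl
sum-map-applyUpTo h f (suc n) = cong (_+_ (h (f 0))) (sum-map-applyUpTo h (λ i → f (suc i)) n)

∑-cong< : ∀ n {f g : ℕ → ℕ} → (∀ i → i < n → f i ≡ g i) → ∑ n f ≡ ∑ n g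
∑-cong< zero    f≗g = refl
∑-cong< (suc n) f≗g = cong₂ _+_ (f≗g 0 z<s) (∑-cong< n (λ i i<n → f≗g (suc i) (s<s i<n)))

∑-cong : ∀ n {f g : ℕ → ℕ} → (∀ i → f i ≡ g i) → ∑ n f ≡ ∑ n g
∑-cong n f≗g = ∑-cong< n (λ i _ → f≗g i)

∑-+ : ∀ m n f → ∑ (m + n) f ≡ ∑ m f + ∑ n (λ i → f (m + i))
∑-+ zero    n f = refl
∑-+ (suc m) n f = trans (cong (_+_ (f 0)) (∑-+ m n (λ i → f (suc i)))) (sym (+-assoc (f 0) _ _))

∑-mono-≤ : ∀ f {m n} → m ≤ n → ∑ m f ≤ ∑ n f
∑-mono-≤ f {m} {n} m≤n = begin
  ∑ m f                                ≤⟨ m≤m+n _ _ ⟩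
  ∑ m f + ∑ (n ∸ m) (λ i → f (m + i))  ≡⟨ ∑-+ m (n ∸ m) f ⟨
  ∑ (m + (n ∸ m)) f                    ≡⟨ cong (λ j → ∑ j f) (m+[n∸m]≡n m≤n) ⟩
  ∑ n f                                ∎
  where open ≤-Reasoning

∑-periodic : ∀ p t f → (∀ i → f (p + i) ≡ f i) → ∑ (t * p) f ≡ t * ∑ p f
∑-periodic p zero    f per = refl
∑-periodic p (suc t) f per = begin
  ∑ (p + t * p) f                      ≡⟨ ∑-+ p (t * p) f ⟩
  ∑ p f + ∑ (t * p) (λ i → f (p + i))  ≡⟨ cong (_+_ (∑ p f)) (∑-cong (t * p) per) ⟩
  ∑ p f + ∑ (t * p) f                  ≡⟨ cong (_+_ (∑ p f)) (∑-periodic p t f per) ⟩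
  ∑ p f + t * ∑ p f                    ∎
  where open ≡-Reasoning

∑-𝟙-false : ∀ n (g : ℕ → Bool) → (∀ i → i < n → g i ≡ false) → ∑ n (λ i → 𝟙 (g i)) ≡ 0
∑-𝟙-false zero    g none = refl
∑-𝟙-false (suc n) g none rewrite none 0 z<s =
  ∑-𝟙-false n (λ i → g (suc i)) (λ i i<n → none (suc i) (s<s i<n))

∑-𝟙-≤1 : ∀ n (g : ℕ → Bool) → (∀ {i j} → i < j → j < n → g i ≡ true → g j ≡ true → ⊥) →
         ∑ n (λ i → 𝟙 (g i)) ≤ 1
∑-𝟙-≤1 zero    g apart = z≤n
∑-𝟙-≤1 (suc n) g apart with g 0 in g0
... | true  = ≤-reflexive (cong suc (∑-𝟙-false n (λ i → g (suc i)) rest-false))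
  where
  rest-false : ∀ i → i < n → g (suc i) ≡ false
  rest-false i i<n with g (suc i) in gi
  ... | false = refl
  ... | true  = ⊥-elim (apart z<s (s<s i<n) g0 gi)
... | false = ∑-𝟙-≤1 n (λ i → g (suc i)) (λ i<j j<n → apart (s<s i<j) (s<s j<n))

window : Subsetℤ → ℤ → ℕ → ℕ
window A z n = ∑ n (λ i → 𝟙 (A (z ℤ.+ + i)))

count≡window : ∀ A N → count A N ≡ window A (ℤ.- + N) (suc (2 * N))
count≡window A N = trans (sum-map-applyUpTo _ (λ i → i) (suc (2 * N)))
  (∑-cong (suc (2 * N)) (λ i → cong (λ x → 𝟙 (A x)) (ℤₚ.+-comm (+ i) (ℤ.- + N))))

window-+ : ∀ A z m n → window A z (m + n) ≡ window A z m + window A (z ℤ.+ + m) n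
window-+ A z m n = trans (∑-+ m n _) (cong (_+_ (window A z m))
  (∑-cong n (λ i → cong (λ x → 𝟙 (A x)) (trans (cong (ℤ._+_ z) (ℤₚ.pos-+ m i)) (sym (ℤₚ.+-assoc z (+ m) (+ i)))))))

window-≤-* : ∀ A w {s} → (∀ z → window A z w ≤ s) → ∀ t z → window A z (t * w) ≤ t * s
window-≤-* A w {s} bound zero    z = z≤n
window-≤-* A w {s} bound (suc t) z = begin
  window A z (w + t * w)                        ≡⟨ window-+ A z w (t * w) ⟩
  window A z w + window A (z ℤ.+ + w) (t * w)   ≤⟨ +-mono-≤ (bound z) (window-≤-* A w bound t (z ℤ.+ + w)) ⟩
  s + t * s                                     ∎
  where open ≤-Reasoning

window-≤-linear : ∀ A {w s} .{{_ : NonZero w}} → (∀ z → window A z w ≤ s) →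
                  ∀ z n → window A z n * w ≤ s * n + s * w
window-≤-linear A {w} {s} bound z n = begin
  window A z n * w             ≤⟨ *-monoˡ-≤ w (∑-mono-≤ _ n≤tw) ⟩
  window A z (t * w) * w       ≤⟨ *-monoˡ-≤ w (window-≤-* A w bound t z) ⟩
  t * s * w                    ≡⟨ regroup t s w ⟩
  s * (w + n / w * w)          ≤⟨ *-monoʳ-≤ s (+-monoʳ-≤ w (m/n*n≤m n w)) ⟩
  s * (w + n)                  ≡⟨ trans (*-distribˡ-+ s w n) (+-comm (s * w) (s * n)) ⟩
  s * n + s * w                ∎
  where
  open ≤-Reasoning
  t = suc (n / w)
  regroup : ∀ t s w → t * s * w ≡ s * (t * w)
  regroup = solve-∀
  n≤tw : n ≤ t * w
  n≤tw = begin
    n                 ≡⟨ m≡m%n+[m/n]*n n w ⟩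
    n % w + n / w * w ≤⟨ +-monoˡ-≤ _ (<⇒≤ (m%n<n n w)) ⟩
    w + n / w * w     ∎

∣z+j-z+i∣≡j∸i : ∀ z {i j} → i ≤ j → ∣ (z ℤ.+ + j) ℤ.- (z ℤ.+ + i) ∣ ≡ j ∸ i
∣z+j-z+i∣≡j∸i z {i} {j} i≤j = cong ∣_∣ (begin
  (z ℤ.+ + j) ℤ.- (z ℤ.+ + i)  ≡⟨ cancel-base z (+ j) (+ i) ⟩
  + j ℤ.- + i                  ≡⟨ ℤₚ.m-n≡m⊖n j i ⟩
  j ℤ.⊖ i                      ≡⟨ ℤₚ.⊖-≥ i≤j ⟩
  + (j ∸ i)                    ∎)
  where
  open ≡-Reasoning
  cancel-base : ∀ z a b → (z ℤ.+ a) ℤ.- (z ℤ.+ b) ≡ a ℤ.- b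
  cancel-base = ℤ-Solver.solve-∀

window-≤1 : ∀ ℓ k {A} → Independent S[ ℓ , k ] A → ∀ z → window A z ℓ ≤ 1
window-≤1 ℓ k {A} indep z = ∑-𝟙-≤1 ℓ (λ i → A (z ℤ.+ + i)) apart
  where
  apart : ∀ {i j} → i < j → j < ℓ → A (z ℤ.+ + i) ≡ true → A (z ℤ.+ + j) ≡ true → ⊥
  apart {i} {j} i<j j<ℓ Ai Aj = indep _ _ Aj Ai
    (subst S[ ℓ , k ] (sym (∣z+j-z+i∣≡j∸i z (<⇒≤ i<j)))
      (inj₁ (m<n⇒0<n∸m i<j , ≤-<-trans (m∸n≤m j i) j<ℓ)))

window-≤-quotient : ∀ ℓ m {A} → Independent S[ ℓ , m * ℓ ] A → ∀ z → window A z (suc (m * ℓ)) ≤ m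
window-≤-quotient ℓ m {A} indep z = by-first-point (A (z ℤ.+ + 0)) refl
  where
  open ≤-Reasoning
  k = m * ℓ
  blocks : ∀ y → window A y k ≤ m
  blocks y = subst (window A y k ≤_) (*-identityʳ m) (window-≤-* A ℓ (window-≤1 ℓ k indep) m y)
  last-empty : A (z ℤ.+ + 0) ≡ true → A (z ℤ.+ + k ℤ.+ + 0) ≡ false
  last-empty first with A (z ℤ.+ + k ℤ.+ + 0) in last
  ... | false = refl
  ... | true  = ⊥-elim (indep (z ℤ.+ + k) (z ℤ.+ + 0) (subst (λ x → A x ≡ true) (ℤₚ.+-identityʳ _) last) first
    (subst S[ ℓ , k ] (sym (∣z+j-z+i∣≡j∸i z z≤n)) (inj₂ refl)))
  by-first-point : ∀ b → A (z ℤ.+ + 0) ≡ b → window A z (suc k) ≤ m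
  by-first-point false first = begin
    window A z (1 + k)                                  ≡⟨ window-+ A z 1 k ⟩
    𝟙 (A (z ℤ.+ + 0)) + 0 + window A (z ℤ.+ + 1) k      ≡⟨ cong (λ b → 𝟙 b + 0 + window A (z ℤ.+ + 1) k) first ⟩
    window A (z ℤ.+ + 1) k                              ≤⟨ blocks (z ℤ.+ + 1) ⟩
    m                                                   ∎
  by-first-point true first = begin
    window A z (suc k)                                  ≡⟨ cong (window A z) (+-comm 1 k) ⟩
    window A z (k + 1)                                  ≡⟨ window-+ A z k 1 ⟩
    window A z k + (𝟙 (A (z ℤ.+ + k ℤ.+ + 0)) + 0)      ≡⟨ cong (λ b → window A z k + (𝟙 b + 0)) (last-empty first) ⟩
    window A z k + 0                                    ≡⟨ +-identityʳ _ ⟩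
    window A z k                                        ≤⟨ blocks z ⟩
    m                                                   ∎

count-≤ : ∀ A {w s} .{{_ : NonZero w}} → (∀ z → window A z w ≤ s) →
          ∀ N → count A N * w ≤ s * suc (2 * N) + s * w
count-≤ A {w} {s} bound N =
  subst (λ c → c * w ≤ s * suc (2 * N) + s * w) (sym (count≡window A N)) (window-≤-linear A bound (ℤ.- + N) (suc (2 * N)))

toℚᵘ-/ : ∀ n d → ℚ.toℚᵘ ((+ n) ℚ./ suc d) ℚᵘ.≃ mkℚᵘ (+ n) d
toℚᵘ-/ n d = ℚₚ.toℚᵘ-fromℚᵘ (mkℚᵘ (+ n) d)

mkℚᵘ-≤ : ∀ {a b c d} (n : ℤ) → n ≡ + c → a * suc d ≤ c * suc b → mkℚᵘ (+ a) b ℚᵘ.≤ mkℚᵘ n d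
mkℚᵘ-≤ {a} {b} {c} {d} _ refl ad≤cb =
  *≤* (subst₂ ℤ._≤_ (ℤₚ.pos-* a (suc d)) (ℤₚ.pos-* c (suc b)) (ℤ.+≤+ ad≤cb))

*≤*⇒/≤/ : ∀ {a b c d} → a * suc d ≤ c * suc b → (+ a) ℚ./ suc b ℚ.≤ (+ c) ℚ./ suc d
*≤*⇒/≤/ {a} {b} {c} {d} ad≤cb = ℚₚ.toℚᵘ-cancel-≤
  (ℚᵘₚ.≤-respˡ-≃ (ℚᵘₚ.≃-sym (toℚᵘ-/ a b))
  (ℚᵘₚ.≤-respʳ-≃ (ℚᵘₚ.≃-sym (toℚᵘ-/ c d)) (mkℚᵘ-≤ (+ c) refl ad≤cb)))

*≤*⇒/≤/+mkℚ : ∀ {a b c d e n} .{cop : Coprime (suc n) (suc d)} →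
  c * (suc b * suc d) ≤ (a * suc d + suc n * suc b) * suc e →
  (+ c) ℚ./ suc e ℚ.≤ (+ a) ℚ./ suc b ℚ.+ mkℚ (+ suc n) d cop
*≤*⇒/≤/+mkℚ {a} {b} {c} {d} {e} {n} {cop} ineq = ℚₚ.toℚᵘ-cancel-≤
  (ℚᵘₚ.≤-respˡ-≃ (ℚᵘₚ.≃-sym (toℚᵘ-/ c e))
  (ℚᵘₚ.≤-respʳ-≃ (ℚᵘₚ.≃-sym sum≃) (mkℚᵘ-≤ _ numerator ineq)))
  where
  ε = mkℚ (+ suc n) d cop
  sum≃ : ℚ.toℚᵘ ((+ a) ℚ./ suc b ℚ.+ ε) ℚᵘ.≃ mkℚᵘ (+ a) b ℚᵘ.+ mkℚᵘ (+ suc n) d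
  sum≃ = ℚᵘₚ.≃-trans (ℚₚ.toℚᵘ-homo-+ ((+ a) ℚ./ suc b) ε) (ℚᵘₚ.+-congˡ (ℚ.toℚᵘ ε) (toℚᵘ-/ a b))
  numerator : + a ℤ.* + suc d ℤ.+ + suc n ℤ.* + suc b ≡ + (a * suc d + suc n * suc b)
  numerator = sym (cong₂ ℤ._+_ (ℤₚ.pos-* a (suc d)) (ℤₚ.pos-* (suc n) (suc b)))

-- With ε = (n + 1)/(d + 1), the error term c is at most ε (2N + 1) as soon as N ≥ c (d + 1).
upperDensity≤-of-count : ∀ A a b c .{{_ : NonZero b}} →
  (∀ N → count A N * b ≤ a * suc (2 * N) + c) → UpperDensity≤ A (frac a b)
upperDensity≤-of-count A a b@(suc b') c bound (mkℚ (+ suc n) d _) _ = c * suc d , close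
  where
  close : ∀ N → c * suc d ≤ N → densityAt A N ℚ.≤ frac a b ℚ.+ mkℚ (+ suc n) d _
  close N cd≤N = *≤*⇒/≤/+mkℚ {a} {b'} {count A N} {d} {2 * N} {n} (begin
    count A N * (b * suc d)                ≡⟨ *-assoc (count A N) b (suc d) ⟨
    count A N * b * suc d                  ≤⟨ *-monoˡ-≤ (suc d) (bound N) ⟩
    (a * L + c) * suc d                    ≡⟨ *-distribʳ-+ (suc d) (a * L) c ⟩
    a * L * suc d + c * suc d              ≤⟨ +-monoʳ-≤ (a * L * suc d) cd≤L ⟩
    a * L * suc d + L                      ≤⟨ +-monoʳ-≤ (a * L * suc d) (m≤n*m L (suc n * b)) ⟩
    a * L * suc d + suc n * b * L          ≡⟨ regroup a L (suc d) (suc n * b) ⟩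
    (a * suc d + suc n * b) * L            ∎)
    where
    open ≤-Reasoning
    L = suc (2 * N)
    cd≤L : c * suc d ≤ L
    cd≤L = ≤-trans cd≤N (≤-trans (m≤m+n N (N + 0)) (n≤1+n _))
    regroup : ∀ a L d e → a * L * d + e * L ≡ (a * d + e) * L
    regroup = solve-∀
upperDensity≤-of-count A a (suc _) c bound (mkℚ (+ zero) _ _) ()
upperDensity≤-of-count A a (suc _) c bound (mkℚ -[1+ _ ] _ _) ()

p-q≤p : ∀ p {q} → ℚ.Positive q → p ℚ.- q ℚ.≤ p
p-q≤p p {q} q>0 = subst (p ℚ.- q ℚ.≤_) (ℚₚ.+-identityʳ p)
  (ℚₚ.+-monoʳ-≤ p (ℚₚ.neg-antimono-≤ (ℚₚ.<⇒≤ (ℚₚ.positive⁻¹ q {{q>0}}))))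

upperDensity≥-antitone : ∀ {A r r′} → r′ ℚ.≤ r → UpperDensity≥ A r → UpperDensity≥ A r′
upperDensity≥-antitone r′≤r dense ε ε>0 M with dense ε ε>0 M
... | N , M≤N , r-ε≤δ = N , M≤N , ℚₚ.≤-trans (ℚₚ.+-monoˡ-≤ (ℚ.- ε) r′≤r) r-ε≤δ

upperDensity≥-of-count : ∀ A a b .{{_ : NonZero b}} →
  (∀ M → Σ ℕ λ N → M ≤ N × a * suc (2 * N) ≤ count A N * b) → UpperDensity≥ A (frac a b)
upperDensity≥-of-count A a (suc b') often ε ε>0 M with often M
... | N , M≤N , dense =
  N , M≤N , ℚₚ.≤-trans (p-q≤p (frac a (suc b')) ε>0) (*≤*⇒/≤/ {a} {b'} {count A N} {2 * N} dense)

independenceRatio-attained : ∀ S r → (∀ A → Independent S A → UpperDensity≤ A r) →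
  ∀ A → Independent S A → UpperDensity≥ A r → IndependenceRatio≡ S r
independenceRatio-attained S r upper A indep dense =
  upper , λ ε ε>0 → A , indep , upperDensity≥-antitone {A} (p-q≤p r {ε} ε>0) dense

%ℕ-unique : ∀ x p .{{_ : NonZero p}} q {r} → r < p → x ≡ + r ℤ.+ q ℤ.* + p → x %ℕ p ≡ r
%ℕ-unique x p q {r} r<p x≡r+qp = ℤₚ.+-injective (ℤₚ.i-j≡0⇒i≡j _ _ (ℤₚ.∣i∣≡0⇒i≡0 gap≡0))
  where
  r′ = x %ℕ p
  q′ = x /ℕ p
  shift : ∀ a b c d e → a ℤ.+ c ℤ.* e ≡ b ℤ.+ d ℤ.* e → a ℤ.- b ≡ (d ℤ.- c) ℤ.* e
  shift a b c d e eq = begin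
    a ℤ.- b                                    ≡⟨ rearrange a b c e ⟩
    (a ℤ.+ c ℤ.* e) ℤ.- (b ℤ.+ c ℤ.* e)        ≡⟨ cong (λ u → u ℤ.- (b ℤ.+ c ℤ.* e)) eq ⟩
    (b ℤ.+ d ℤ.* e) ℤ.- (b ℤ.+ c ℤ.* e)        ≡⟨ collect b c d e ⟩
    (d ℤ.- c) ℤ.* e                            ∎
    where
    open ≡-Reasoning
    rearrange : ∀ a b c e → a ℤ.- b ≡ (a ℤ.+ c ℤ.* e) ℤ.- (b ℤ.+ c ℤ.* e)
    rearrange = ℤ-Solver.solve-∀
    collect : ∀ b c d e → (b ℤ.+ d ℤ.* e) ℤ.- (b ℤ.+ c ℤ.* e) ≡ (d ℤ.- c) ℤ.* e
    collect = ℤ-Solver.solve-∀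
  gap : ∣ + r′ ℤ.- + r ∣ ≡ ∣ q ℤ.- q′ ∣ * p
  gap = trans (cong ∣_∣ (shift (+ r′) (+ r) q′ q (+ p) (trans (sym (a≡a%ℕn+[a/ℕn]*n x p)) x≡r+qp)))
              (ℤₚ.∣i*j∣≡∣i∣*∣j∣ (q ℤ.- q′) (+ p))
  gap<p : ∣ + r′ ℤ.- + r ∣ < p
  gap<p = begin-strict
    ∣ + r′ ℤ.- + r ∣  ≡⟨ cong ∣_∣ (ℤₚ.m-n≡m⊖n r′ r) ⟩
    ∣ r′ ℤ.⊖ r ∣      ≤⟨ ℤₚ.∣m⊝n∣≤m⊔n r′ r ⟩
    r′ ⊔ r            <⟨ ⊔-lub (n%ℕd<d x p) r<p ⟩
    p                 ∎
    where open ≤-Reasoning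
  gap≡0 : ∣ + r′ ℤ.- + r ∣ ≡ 0
  gap≡0 = trans gap (cong (_* p) (n<1⇒n≡0 (*-cancelʳ-< p ∣ q ℤ.- q′ ∣ 1
    (subst₂ _<_ gap (sym (*-identityˡ p)) gap<p))))

%ℕ-+ : ∀ x p .{{_ : NonZero p}} d → (x ℤ.+ + d) %ℕ p ≡ (x %ℕ p + d) % p
%ℕ-+ x p d = %ℕ-unique (x ℤ.+ + d) p (x /ℕ p ℤ.+ + (s / p)) (m%n<n s p) (begin
  x ℤ.+ + d                                             ≡⟨ cong (ℤ._+ + d) (a≡a%ℕn+[a/ℕn]*n x p) ⟩
  + (x %ℕ p) ℤ.+ x /ℕ p ℤ.* + p ℤ.+ + d                 ≡⟨ swap (+ (x %ℕ p)) (x /ℕ p ℤ.* + p) (+ d) ⟩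
  + s ℤ.+ x /ℕ p ℤ.* + p                                ≡⟨ cong (ℤ._+ x /ℕ p ℤ.* + p) (a≡a%ℕn+[a/ℕn]*n (+ s) p) ⟩
  + (s % p) ℤ.+ + (s / p) ℤ.* + p ℤ.+ x /ℕ p ℤ.* + p   ≡⟨ collect (+ (s % p)) (+ (s / p)) (x /ℕ p) (+ p) ⟩
  + (s % p) ℤ.+ (x /ℕ p ℤ.+ + (s / p)) ℤ.* + p         ∎)
  where
  open ≡-Reasoning
  s = x %ℕ p + d
  swap : ∀ a b c → a ℤ.+ b ℤ.+ c ≡ a ℤ.+ c ℤ.+ b
  swap = ℤ-Solver.solve-∀
  collect : ∀ r a b p → r ℤ.+ a ℤ.* p ℤ.+ b ℤ.* p ≡ r ℤ.+ (b ℤ.+ a) ℤ.* p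
  collect = ℤ-Solver.solve-∀

-[M*p]%ℕp≡0 : ∀ M p .{{_ : NonZero p}} → (ℤ.- + (M * p)) %ℕ p ≡ 0
-[M*p]%ℕp≡0 M p = %ℕ-unique _ p (ℤ.- + M) (>-nonZero⁻¹ p)
  (trans (cong ℤ.-_ (ℤₚ.pos-* M p)) (negate-product (+ M) (+ p)))
  where
  negate-product : ∀ m p → ℤ.- (m ℤ.* p) ≡ + 0 ℤ.+ ℤ.- m ℤ.* p
  negate-product = ℤ-Solver.solve-∀

residueSet : ∀ p .{{_ : NonZero p}} {P : ℕ → Set} → (∀ r → Dec (P r)) → Subsetℤ
residueSet p P? x = does (P? (x %ℕ p))

does⇒ : ∀ {P : Set} (P? : Dec P) → does P? ≡ true → P
does⇒ (yes p) _ = p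

independent-of-forward : ∀ {S A} → (∀ x d → A x ≡ true → A (x ℤ.+ + d) ≡ true → ¬ S d) → Independent S A
independent-of-forward {S} {A} avoid i j Ai Aj with i ℤ.- j in i-j
... | + d      = avoid j d Aj (subst (λ x → A x ≡ true) (trans (split i j) (cong (ℤ._+_ j) i-j)) Ai)
  where
  split : ∀ i j → i ≡ j ℤ.+ (i ℤ.- j)
  split = ℤ-Solver.solve-∀
... | -[1+ n ] = avoid i (suc n) Ai (subst (λ x → A x ≡ true) (trans (split i j) (cong (ℤ._-_ i) i-j)) Aj)
  where
  split : ∀ i j → j ≡ i ℤ.- (i ℤ.- j)
  split = ℤ-Solver.solve-∀

residueSet-independent : ∀ {S} p .{{_ : NonZero p}} {P : ℕ → Set} (P? : ∀ r → Dec (P r)) →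
  (∀ r d → r < p → P r → P ((r + d) % p) → ¬ S d) → Independent S (residueSet p P?)
residueSet-independent p {P} P? avoid = independent-of-forward λ x d Ax Ax+d →
  avoid (x %ℕ p) d (n%ℕd<d x p) (does⇒ (P? _) Ax) (subst P (%ℕ-+ x p d) (does⇒ (P? _) Ax+d))

count-residueSet : ∀ p .{{_ : NonZero p}} {P : ℕ → Set} (P? : ∀ r → Dec (P r)) → P 0 →
  ∀ M → count (residueSet p P?) (M * p) ≡ 2 * M * ∑ p (λ r → 𝟙 (does (P? r))) + 1
count-residueSet p P? P0 M = begin
  count A N                                               ≡⟨ count≡window A N ⟩
  window A (ℤ.- + N) (suc (2 * N))                        ≡⟨ ∑-cong (suc (2 * N)) (λ i → cong g (from-origin i)) ⟩
  ∑ (suc (2 * N)) (λ i → g (i % p))                       ≡⟨ cong (λ n → ∑ n (λ i → g (i % p))) length ⟩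
  ∑ (2 * M * p + 1) (λ i → g (i % p))                     ≡⟨ ∑-+ (2 * M * p) 1 _ ⟩
  ∑ (2 * M * p) (λ i → g (i % p)) + (g ((2 * M * p + 0) % p) + 0) ≡⟨ cong₂ _+_ full-periods last-point ⟩
  2 * M * ∑ p g + 1                                       ∎
  where
  open ≡-Reasoning
  A = residueSet p P?
  N = M * p
  g : ℕ → ℕ
  g r = 𝟙 (does (P? r))
  from-origin : ∀ i → (ℤ.- + N ℤ.+ + i) %ℕ p ≡ i % p
  from-origin i = trans (%ℕ-+ (ℤ.- + N) p i) (cong (λ r → (r + i) % p) (-[M*p]%ℕp≡0 M p))
  length : suc (2 * N) ≡ 2 * M * p + 1
  length = trans (+-comm 1 (2 * N)) (cong (_+ 1) (sym (*-assoc 2 M p)))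
  full-periods : ∑ (2 * M * p) (λ i → g (i % p)) ≡ 2 * M * ∑ p g
  full-periods = trans
    (∑-periodic p (2 * M) _ (λ i → cong g (trans (cong (_% p) (+-comm p i)) ([m+n]%n≡m%n i p))))
    (cong (2 * M *_) (∑-cong< p (λ i i<p → cong g (m<n⇒m%n≡m i<p))))
  last-point : g ((2 * M * p + 0) % p) + 0 ≡ 1
  last-point = begin
    g ((2 * M * p + 0) % p) + 0  ≡⟨ +-identityʳ _ ⟩
    g ((2 * M * p + 0) % p)      ≡⟨ cong (λ n → g (n % p)) (+-identityʳ _) ⟩
    g ((2 * M * p) % p)          ≡⟨ cong g (m*n%n≡0 (2 * M) p) ⟩
    g 0                          ≡⟨ cong 𝟙 (dec-true (P? 0) P0) ⟩
    1                            ∎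

∑-divisible-block : ∀ ℓ .{{_ : NonZero ℓ}} → ∑ ℓ (λ r → 𝟙 (does (ℓ ∣? r))) ≡ 1
∑-divisible-block ℓ@(suc l) = cong₂ _+_ (cong 𝟙 (dec-true (ℓ ∣? 0) (ℓ ∣0)))
  (∑-𝟙-false l _ (λ i i<l → dec-false (ℓ ∣? suc i) (>⇒∤ (s<s i<l))))

∑-divisible : ∀ ℓ .{{_ : NonZero ℓ}} m → ∑ (m * ℓ) (λ r → 𝟙 (does (ℓ ∣? r))) ≡ m
∑-divisible ℓ m = begin
  ∑ (m * ℓ) (λ r → 𝟙 (does (ℓ ∣? r)))  ≡⟨ ∑-periodic ℓ m _ (λ i → cong 𝟙 (does-⇔ (shift i) (ℓ ∣? (ℓ + i)) (ℓ ∣? i))) ⟩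
  m * ∑ ℓ (λ r → 𝟙 (does (ℓ ∣? r)))    ≡⟨ cong (m *_) (∑-divisible-block ℓ) ⟩
  m * 1                                ≡⟨ *-identityʳ m ⟩
  m                                    ∎
  where
  open ≡-Reasoning
  shift : ∀ i → (ℓ ∣ ℓ + i) ⇔ (ℓ ∣ i)
  shift i = mk⇔ (λ ℓ∣ℓ+i → ∣m+n∣m⇒∣n ℓ∣ℓ+i ∣-refl) (∣m∣n⇒∣m+n ∣-refl)

0<d<ℓ⇒ℓ∤d : ∀ {ℓ d} → 0 < d → d < ℓ → ¬ ℓ ∣ d
0<d<ℓ⇒ℓ∤d 0<d d<ℓ = >⇒∤ {{>-nonZero 0<d}} d<ℓ

∣%⇒∣ : ∀ ℓ .{{_ : NonZero ℓ}} x → ℓ ∣ x % ℓ → ℓ ∣ x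
∣%⇒∣ ℓ x ℓ∣x%ℓ = m%n≡0⇒n∣m x ℓ (trans (sym (m%n%n≡m%n x ℓ)) (n∣m⇒m%n≡0 (x % ℓ) ℓ ℓ∣x%ℓ))

∣∧<⇒≡0 : ∀ {ℓ r} .{{_ : NonZero ℓ}} → ℓ ∣ r → r < ℓ → r ≡ 0
∣∧<⇒≡0 {ℓ} {r} ℓ∣r r<ℓ = trans (sym (m<n⇒m%n≡m r<ℓ)) (n∣m⇒m%n≡0 r ℓ ℓ∣r)

∣∧<⇒+≤ : ∀ {ℓ m r} → ℓ ∣ r → r < m * ℓ → r + ℓ ≤ m * ℓ
∣∧<⇒+≤ {ℓ} {m} (divides q refl) qℓ<mℓ =
  subst (_≤ m * ℓ) (+-comm ℓ (q * ℓ)) (*-monoˡ-≤ ℓ (*-cancelʳ-< ℓ q m qℓ<mℓ))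

multiplesOf : ∀ ℓ .{{_ : NonZero ℓ}} → Subsetℤ
multiplesOf ℓ = residueSet ℓ (ℓ ∣?_)

multiplesOf-independent : ∀ ℓ k .{{_ : NonZero ℓ}} → ¬ ℓ ∣ k → Independent S[ ℓ , k ] (multiplesOf ℓ)
multiplesOf-independent ℓ k ℓ∤k = residueSet-independent ℓ (ℓ ∣?_) avoid
  where
  excluded : ∀ {d} → ℓ ∣ d → ¬ S[ ℓ , k ] d
  excluded ℓ∣d (inj₁ (0<d , d<ℓ)) = 0<d<ℓ⇒ℓ∤d 0<d d<ℓ ℓ∣d
  excluded ℓ∣d (inj₂ refl)        = ℓ∤k ℓ∣d
  avoid : ∀ r d → r < ℓ → ℓ ∣ r → ℓ ∣ (r + d) % ℓ → ¬ S[ ℓ , k ] d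
  avoid r d r<ℓ ℓ∣r ℓ∣r+d =
    excluded (∣%⇒∣ ℓ d (subst (λ r → ℓ ∣ (r + d) % ℓ) (∣∧<⇒≡0 ℓ∣r r<ℓ) ℓ∣r+d))

count-multiplesOf : ∀ ℓ .{{_ : NonZero ℓ}} M → count (multiplesOf ℓ) (M * ℓ) ≡ 2 * M * 1 + 1
count-multiplesOf ℓ M = trans (count-residueSet ℓ (ℓ ∣?_) (ℓ ∣0) M)
  (cong (λ c → 2 * M * c + 1) (∑-divisible-block ℓ))

independenceRatio-∤ : ∀ ℓ k .{{_ : NonZero ℓ}} → ¬ ℓ ∣ k → IndependenceRatio≡ S[ ℓ , k ] (frac 1 ℓ)
independenceRatio-∤ ℓ k ℓ∤k = independenceRatio-attained S[ ℓ , k ] (frac 1 ℓ)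
  (λ A indep → upperDensity≤-of-count A 1 ℓ (1 * ℓ) (count-≤ A (window-≤1 ℓ k indep)))
  (multiplesOf ℓ) (multiplesOf-independent ℓ k ℓ∤k)
  (upperDensity≥-of-count (multiplesOf ℓ) 1 ℓ (λ M → M * ℓ , m≤m*n M ℓ , dense M))
  where
  dense : ∀ M → 1 * suc (2 * (M * ℓ)) ≤ count (multiplesOf ℓ) (M * ℓ) * ℓ
  dense M = begin
    1 * suc (2 * (M * ℓ))           ≡⟨ lhs M ℓ ⟩
    1 + 2 * (M * ℓ)                 ≤⟨ +-monoˡ-≤ (2 * (M * ℓ)) (>-nonZero⁻¹ ℓ) ⟩
    ℓ + 2 * (M * ℓ)                 ≡⟨ rhs M ℓ ⟩
    (2 * M * 1 + 1) * ℓ             ≡⟨ cong (_* ℓ) (count-multiplesOf ℓ M) ⟨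
    count (multiplesOf ℓ) (M * ℓ) * ℓ ∎
    where
    open ≤-Reasoning
    lhs : ∀ M ℓ → 1 * suc (2 * (M * ℓ)) ≡ 1 + 2 * (M * ℓ)
    lhs = solve-∀
    rhs : ∀ M ℓ → ℓ + 2 * (M * ℓ) ≡ (2 * M * 1 + 1) * ℓ
    rhs = solve-∀

periodicMultiples : ℕ → ℕ → Subsetℤ
periodicMultiples ℓ k = residueSet (suc k) (λ r → ℓ ∣? r ×-dec r <? k)

-- A forward step of length d < ℓ stays inside the period and cannot join two multiples of ℓ;
-- a step of length k either lands on the excluded residue k or shifts the residue down by one.
periodicMultiples-independent : ∀ ℓ m → 2 ≤ ℓ → Independent S[ ℓ , m * ℓ ] (periodicMultiples ℓ (m * ℓ))
periodicMultiples-independent ℓ m 2≤ℓ = residueSet-independent (suc k) (λ r → ℓ ∣? r ×-dec r <? k) avoid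
  where
  k = m * ℓ
  avoid : ∀ r d → r < suc k → ℓ ∣ r × r < k → ℓ ∣ (r + d) % suc k × (r + d) % suc k < k → ¬ S[ ℓ , k ] d
  avoid r d _ (ℓ∣r , r<k) (ℓ∣r′ , r′<k) (inj₁ (0<d , d<ℓ)) = 0<d<ℓ⇒ℓ∤d 0<d d<ℓ (∣m+n∣m⇒∣n ℓ∣r+d ℓ∣r)
    where
    r+d<1+k : r + d < suc k
    r+d<1+k = s≤s (≤-trans (+-monoʳ-≤ r (<⇒≤ d<ℓ)) (∣∧<⇒+≤ {m = m} ℓ∣r r<k))
    ℓ∣r+d : ℓ ∣ r + d
    ℓ∣r+d = subst (ℓ ∣_) (m<n⇒m%n≡m r+d<1+k) ℓ∣r′
  avoid zero d _ _ (_ , r′<k) (inj₂ refl) = <-irrefl (m<n⇒m%n≡m (n<1+n k)) r′<k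
  avoid (suc r) d _ (ℓ∣1+r , 1+r<k) (ℓ∣r′ , _) (inj₂ refl) = <⇒≱ 2≤ℓ (≤-reflexive (∣1⇒≡1 ℓ∣1))
    where
    r′≡r : (suc r + k) % suc k ≡ r
    r′≡r = trans (cong (_% suc k) (sym (+-suc r k)))
      (trans ([m+n]%n≡m%n r (suc k)) (m<n⇒m%n≡m (<-trans (n<1+n r) (<-trans 1+r<k (n<1+n k)))))
    ℓ∣1 : ℓ ∣ 1
    ℓ∣1 = ∣m+n∣m⇒∣n (subst (ℓ ∣_) (+-comm 1 r) ℓ∣1+r) (subst (ℓ ∣_) r′≡r ℓ∣r′)

∑-periodicMultiples : ∀ ℓ .{{_ : NonZero ℓ}} m → ∑ (suc (m * ℓ)) (λ r → 𝟙 (does (ℓ ∣? r ×-dec r <? m * ℓ))) ≡ m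
∑-periodicMultiples ℓ m = begin
  ∑ (suc k) g                             ≡⟨ cong (λ n → ∑ n g) (+-comm 1 k) ⟩
  ∑ (k + 1) g                             ≡⟨ ∑-+ k 1 g ⟩
  ∑ k g + (g (k + 0) + 0)                 ≡⟨ cong₂ _+_ below-k at-k ⟩
  ∑ k (λ r → 𝟙 (does (ℓ ∣? r))) + 0       ≡⟨ +-identityʳ _ ⟩
  ∑ k (λ r → 𝟙 (does (ℓ ∣? r)))           ≡⟨ ∑-divisible ℓ m ⟩
  m                                       ∎
  where
  open ≡-Reasoning
  k = m * ℓ
  g : ℕ → ℕ
  g r = 𝟙 (does (ℓ ∣? r ×-dec r <? k))
  below-k : ∑ k g ≡ ∑ k (λ r → 𝟙 (does (ℓ ∣? r)))
  below-k = ∑-cong< k (λ r r<k → cong 𝟙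
    (trans (cong (does (ℓ ∣? r) ∧_) (dec-true (r <? k) r<k)) (∧-identityʳ _)))
  at-k : g (k + 0) + 0 ≡ 0
  at-k = trans (+-identityʳ _) (trans (cong g (+-identityʳ k))
    (cong 𝟙 (trans (cong (does (ℓ ∣? k) ∧_) (dec-false (k <? k) (<-irrefl refl))) (∧-zeroʳ _))))

independenceRatio-∣ : ∀ ℓ m .{{_ : NonZero m}} → 2 ≤ ℓ →
  IndependenceRatio≡ S[ ℓ , m * ℓ ] (frac (m * ℓ) (ℓ * (m * ℓ + 1)))
independenceRatio-∣ ℓ m 2≤ℓ = independenceRatio-attained S[ ℓ , k ] (frac k (ℓ * (k + 1)))
  (λ A indep → upperDensity≤-of-count A k (ℓ * (k + 1)) (k * (k + 1)) (sparse A indep))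
  (periodicMultiples ℓ k) (periodicMultiples-independent ℓ m 2≤ℓ)
  (upperDensity≥-of-count (periodicMultiples ℓ k) k (ℓ * (k + 1)) (λ M → M * suc k , m≤m*n M (suc k) , dense M))
  where
  k = m * ℓ
  instance
    ℓ≢0 : NonZero ℓ
    ℓ≢0 = >-nonZero (≤-trans (s≤s z≤n) 2≤ℓ)
    ℓ[k+1]≢0 : NonZero (ℓ * (k + 1))
    ℓ[k+1]≢0 = m*n≢0 ℓ (k + 1) {{ℓ≢0}} {{≢-nonZero (m+1+n≢0 k)}}
  sparse : ∀ A → Independent S[ ℓ , k ] A → ∀ N → count A N * (ℓ * (k + 1)) ≤ k * suc (2 * N) + k * (k + 1)
  sparse A indep N = begin
    count A N * (ℓ * (m * ℓ + 1))        ≡⟨ pull-ℓ (count A N) ℓ m ⟩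
    ℓ * (count A N * suc k)              ≤⟨ *-monoʳ-≤ ℓ (count-≤ A (window-≤-quotient ℓ m indep) N) ⟩
    ℓ * (m * L + m * suc k)              ≡⟨ distribute ℓ m L ⟩
    m * ℓ * L + m * ℓ * (m * ℓ + 1)      ∎
    where
    open ≤-Reasoning
    L = suc (2 * N)
    pull-ℓ : ∀ c ℓ m → c * (ℓ * (m * ℓ + 1)) ≡ ℓ * (c * suc (m * ℓ))
    pull-ℓ = solve-∀
    distribute : ∀ ℓ m L → ℓ * (m * L + m * suc (m * ℓ)) ≡ m * ℓ * L + m * ℓ * (m * ℓ + 1)
    distribute = solve-∀
  dense : ∀ M → k * suc (2 * (M * suc k)) ≤ count (periodicMultiples ℓ k) (M * suc k) * (ℓ * (k + 1))
  dense M = begin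
    k * suc (2 * (M * suc k))                      ≡⟨ lhs ℓ m M ⟩
    X + m * ℓ                                      ≤⟨ +-monoʳ-≤ X (≤-trans (m≤m+n k 1) (m≤n*m (k + 1) ℓ)) ⟩
    X + ℓ * (m * ℓ + 1)                            ≡⟨ rhs ℓ m M ⟩
    (2 * M * m + 1) * (ℓ * (k + 1))                ≡⟨ cong (_* (ℓ * (k + 1))) count≡ ⟨
    count (periodicMultiples ℓ k) (M * suc k) * (ℓ * (k + 1)) ∎
    where
    open ≤-Reasoning
    X = 2 * M * m * (ℓ * (m * ℓ + 1))
    count≡ : count (periodicMultiples ℓ k) (M * suc k) ≡ 2 * M * m + 1
    count≡ = trans (count-residueSet (suc k) (λ r → ℓ ∣? r ×-dec r <? k) (ℓ ∣0 , >-nonZero⁻¹ k {{m*n≢0 m ℓ}}) M)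
                   (cong (λ c → 2 * M * c + 1) (∑-periodicMultiples ℓ m))
    lhs : ∀ ℓ m M → m * ℓ * suc (2 * (M * suc (m * ℓ))) ≡ 2 * M * m * (ℓ * (m * ℓ + 1)) + m * ℓ
    lhs = solve-∀
    rhs : ∀ ℓ m M → 2 * M * m * (ℓ * (m * ℓ + 1)) + ℓ * (m * ℓ + 1) ≡ (2 * M * m + 1) * (ℓ * (m * ℓ + 1))
    rhs = solve-∀

theorem22 : (ℓ k : ℕ) → 2 ≤ ℓ → ℓ < k →
    ((¬ (ℓ ∣ k)) → IndependenceRatio≡ S[ ℓ , k ] (frac 1 ℓ)) ×
    (ℓ ∣ k → IndependenceRatio≡ S[ ℓ , k ] (frac k (ℓ * (k + 1))))
theorem22 ℓ k 2≤ℓ ℓ<k = independenceRatio-∤ ℓ k , divisible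
  where
  instance
    ℓ≢0 : NonZero ℓ
    ℓ≢0 = >-nonZero (≤-trans (s≤s z≤n) 2≤ℓ)
  divisible : ℓ ∣ k → IndependenceRatio≡ S[ ℓ , k ] (frac k (ℓ * (k + 1)))
  divisible (divides zero k≡0) = contradiction (subst (ℓ <_) k≡0 ℓ<k) n≮0
  divisible (divides m@(suc _) k≡mℓ) =
    subst (λ k → IndependenceRatio≡ S[ ℓ , k ] (frac k (ℓ * (k + 1)))) (sym k≡mℓ) (independenceRatio-∣ ℓ m 2≤ℓ)
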